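{- Let $r\ge 2$, $n\ge 1$, and suppose rounds $1,\dots,r-1$ have been played (with any strategies) and the answers received are consistent with at least one set of excellent elements. Let $\mathcal F_r$ be a family of queries posed in round $r$ that suffices for the Questioner to reach the goal (find one excellent element or correctly state that there is none). Then $|\mathcal F_r|\ge m_{r-1}-1$ if at least one answer in the first $r-1$ rounds was "yes", and $|\mathcal F_r|\ge n-|G_{r-1}|$ if all answers in the first $r-1$ rounds were "no".
   Context: Setting: an unknown set $E\subseteq[n]$ of excellent elements; in round $t$ the Questioner poses a finite family $\mathcal F_t$ of subsets of $[n]$ (depending on earlier answers); the answer to $A$ is "yes" iff $A\cap E\ne\emptyset$. Notation: $\mathcal F_t^Y,\mathcal F_t^N$ are the queries of round $t$ answered yes/no; $G_t=\bigcup\{F:F\in\mathcal F_j^N, j\le t\}$; $\mathcal G_t=\{F\setminus G_t: F\in\mathcal F_j^Y, j\le t\}$; $m_t=\min\{|B|:B\in\mathcal G_t\}$. A set $E'\subseteq[n]$ is consistent with the answers of rounds $1,\dots,r-1$ iff $E'\cap G_{r-1}=\emptyset$ and $E'$ meets every member of $\mathcal G_{r-1}$. The family $\mathcal F_r$ suffices if for every consistent $E$, letting $\mathcal C$ be the collection of all sets consistent with the answers of rounds $1,\dots,r-1$ that produce the same answers on $\mathcal F_r$ as $E$, either every member of $\mathcal C$ is empty, or some element lies in every member of $\mathcal C$. Standing convention: every member of $\mathcal F_t$ is a subset of $[n]\setminus G_{t-1}$. -}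

module Defs where

open import Data.Nat using (ℕ; zero; suc; _⊓_)
open import Data.Bool using (Bool; true; false)
open import Data.Product using (_×_; _,_; proj₁; proj₂; ∃)
open import Data.Sum using (_⊎_)
open import Data.Unit using (⊤)
open import Data.List using (List; []; _∷_; foldr; map; filter)
open import Data.List.Relation.Unary.All using (All)
open import Data.List.Relation.Unary.Any using (Any)
open import Data.List.Membership.Propositional using () renaming (_∈_ to _∈ₗ_)
open import Data.Fin using (Fin)
open import Data.Fin.Subset using (Subset; _∈_; _⊆_; _∩_; _∪_; _─_; ∁; ⊥; ⋃; ∣_∣; Nonempty; Empty)
open import Relation.Binary.PropositionalEquality using (_≡_)
open import Function.Bundles using (_⇔_)

-- A query together with the answer it received (true = "yes", false = "no").
Query : ℕ → Set
Query n = Subset n × Bool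

Round : ℕ → Set
Round n = List (Query n)

-- A history of rounds 1, …, t, in chronological order (round 1 first).
History : ℕ → Set
History n = List (Round n)

yesQ : ∀ {n} → Round n → List (Subset n)
yesQ []               = []
yesQ ((A , true) ∷ R)  = A ∷ yesQ R
yesQ ((A , false) ∷ R) = yesQ R

noQ : ∀ {n} → Round n → List (Subset n)
noQ []               = []
noQ ((A , true) ∷ R)  = noQ R
noQ ((A , false) ∷ R) = A ∷ noQ R

Meets : ∀ {n} → Subset n → Subset n → Set
Meets A E = Nonempty (A ∩ E)

GFrom : ∀ {n} → Subset n → History n → Subset n
GFrom g []      = g
GFrom g (R ∷ H) = GFrom (g ∪ ⋃ (noQ R)) H

G : ∀ {n} → History n → Subset n
G H = GFrom ⊥ H

allYes : ∀ {n} → History n → List (Subset n)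
allYes []      = []
allYes (R ∷ H) = yesQ R Data.List.++ allYes H

𝓖 : ∀ {n} → History n → List (Subset n)
𝓖 H = map (λ F → F ─ G H) (allYes H)

-- m_t = min { |B| : B ∈ 𝓖_t }  (only used when 𝓖_t is nonempty)
minSize : ∀ {n} → List (Subset n) → ℕ
minSize []       = 0
minSize (B ∷ Bs) = foldr (λ C acc → ∣ C ∣ ⊓ acc) ∣ B ∣ Bs

m : ∀ {n} → History n → ℕ
m H = minSize (𝓖 H)

Consistent : ∀ {n} → History n → Subset n → Set
Consistent H E' = Empty (E' ∩ G H) × All (λ B → Meets B E') (𝓖 H)

ConventionFrom : ∀ {n} → Subset n → History n → Set
ConventionFrom g []      = ⊤
ConventionFrom g (R ∷ H) =
  All (λ q → proj₁ q ⊆ ∁ g) R × ConventionFrom (g ∪ ⋃ (noQ R)) H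

Convention : ∀ {n} → History n → Set
Convention H = ConventionFrom ⊥ H

SameAnswers : ∀ {n} → List (Subset n) → Subset n → Subset n → Set
SameAnswers 𝓕 E E' = All (λ A → Meets A E ⇔ Meets A E') 𝓕

Suffices : ∀ {n} → History n → List (Subset n) → Set
Suffices {n} H 𝓕 =
  (E : Subset n) → Consistent H E →
    ((E' : Subset n) → Consistent H E' → SameAnswers 𝓕 E E' → Empty E')
    ⊎ ∃ λ (x : Fin n) → (E' : Subset n) → Consistent H E' → SameAnswers 𝓕 E E' → x ∈ E'

SomeYes : ∀ {n} → History n → Set
SomeYes H = Any (Any (λ q → proj₂ q ≡ true)) H

-- Write U = ∁ G for the elements not yet excluded.  Removing fewer than m
-- elements from U keeps every member of 𝓖 hit (and if there was no "yes"
-- answer, every subset of U is consistent), so all sets U ─ T with ∣T∣ ≤ K are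
-- consistent, where K = m − 1 resp. K = ∣U∣.  Starting from E = U, a
-- sufficient family must name some x ∈ E lying in every consistent set that
-- answers like E; in particular E - x answers differently, so some query meets
-- E in x alone.  Hence passing from E to E - x loses a "yes" answer, and this
-- can be repeated K times.
module Submission where

open import Defs
open import Data.Nat using (ℕ; zero; suc; _≤_; _<_; _∸_; _+_; _⊓_; z≤n; s≤s)
open import Data.Nat.Properties
open import Data.Product using (∃; _×_; _,_; proj₁; proj₂)
open import Data.Sum using (inj₁; inj₂)
open import Data.Bool using (true; false)
open import Data.Fin using (Fin)
import Data.Fin as Fin
open import Data.List using (List; []; _∷_; length; map; foldr; filter)
open import Data.List.Properties using (length-filter)
open import Data.List.Relation.Unary.All using (All; [])
import Data.List.Relation.Unary.All as All
open import Data.List.Relation.Unary.All.Properties using (¬Any⇒All¬; map⁺)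
open import Data.List.Relation.Unary.Any using (Any; here; there; any?)
open import Data.List.Relation.Unary.Unique.Propositional using (Unique)
open import Data.List.Membership.Propositional using () renaming (_∈_ to _∈ₗ_)
open import Data.List.Relation.Binary.Sublist.Propositional using () renaming (⊆-refl to sublist-refl)
open import Data.List.Relation.Binary.Sublist.Heterogeneous.Properties
  using (length-mono-≤; ⊆-filter-Sublist)
open import Data.Fin.Subset
  using (Subset; _∈_; _∉_; _⊆_; ∁; _∩_; _∪_; _─_; _-_; ⁅_⁆; ∣_∣; Nonempty; Empty; inside; outside)
  renaming (⊥ to ∅)
open import Data.Fin.Subset.Properties
open import Data.Vec using (_∷_) renaming (here to vhere; there to vthere)
open import Function.Base using (_∘′_)
open import Function.Bundles using (mk⇔)
open import Relation.Binary.PropositionalEquality using (_≡_; refl; sym; subst; cong)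
open import Relation.Nullary using (¬_; Dec; yes; no; ¬?; contradiction)
open import Relation.Nullary.Decidable using (_×-dec_; decidable-stable)
open import Relation.Unary using (Pred; Decidable)

p─q⊆∁q : ∀ {n} (p q : Subset n) → p ─ q ⊆ ∁ q
p─q⊆∁q (_ ∷ p) (outside ∷ q) vhere      = vhere
p─q⊆∁q (_ ∷ p) (_       ∷ q) (vthere x) = vthere (p─q⊆∁q p q x)

∣p∪⁅x⁆∣≤1+∣p∣ : ∀ {n} (p : Subset n) (x : Fin n) → ∣ p ∪ ⁅ x ⁆ ∣ ≤ suc ∣ p ∣
∣p∪⁅x⁆∣≤1+∣p∣ (inside  ∷ p) Fin.zero    rewrite ∪-identityʳ p = n≤1+n _
∣p∪⁅x⁆∣≤1+∣p∣ (outside ∷ p) Fin.zero    rewrite ∪-identityʳ p = ≤-refl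
∣p∪⁅x⁆∣≤1+∣p∣ (inside  ∷ p) (Fin.suc x) = s≤s (∣p∪⁅x⁆∣≤1+∣p∣ p x)
∣p∪⁅x⁆∣≤1+∣p∣ (outside ∷ p) (Fin.suc x) = ∣p∪⁅x⁆∣≤1+∣p∣ p x

∣p∣<∣q∣⇒q─p≢∅ : ∀ {n} {p q : Subset n} → ∣ p ∣ < ∣ q ∣ → Nonempty (q ─ p)
∣p∣<∣q∣⇒q─p≢∅ {p = p} {q} ∣p∣<∣q∣ with nonempty? (q ─ p)
... | yes q─p≢∅ = q─p≢∅
... | no  q─p≡∅ = contradiction (p⊆q⇒∣p∣≤∣q∣ q⊆p) (<⇒≱ ∣p∣<∣q∣)
  where
  q⊆p : q ⊆ p
  q⊆p {x} x∈q = decidable-stable (x ∈? p) (λ x∉p → q─p≡∅ (x , x∈p∧x∉q⇒x∈p─q x∈q x∉p))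

p⊆∁q⇒Empty[p∩q] : ∀ {n} {p q : Subset n} → p ⊆ ∁ q → Empty (p ∩ q)
p⊆∁q⇒Empty[p∩q] {p = p} {q} p⊆∁q (x , x∈p∩q) =
  x∈∁p⇒x∉p (p⊆∁q (proj₁ (x∈p∩q⁻ p q x∈p∩q))) (proj₂ (x∈p∩q⁻ p q x∈p∩q))

module _ {a p q} {A : Set a} {P : Pred A p} {Q : Pred A q}
         (P? : Decidable P) (Q? : Decidable Q) (P⊆Q : ∀ {x} → P x → Q x) where

  length-filter-mono : ∀ xs → length (filter P? xs) ≤ length (filter Q? xs)
  length-filter-mono xs =
    length-mono-≤ (⊆-filter-Sublist P? Q? (λ { refl → P⊆Q }) (sublist-refl {x = xs}))

  length-filter-strict : ∀ {xs} → Any (λ x → Q x × ¬ P x) xs →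
                         length (filter P? xs) < length (filter Q? xs)
  length-filter-strict {x ∷ xs} (here (qx , ¬px)) with P? x | Q? x
  ... | yes px | _      = contradiction px ¬px
  ... | no  _  | yes _  = s≤s (length-filter-mono xs)
  ... | no  _  | no ¬qx = contradiction qx ¬qx
  length-filter-strict {x ∷ xs} (there any) with P? x | Q? x
  ... | yes px | no ¬qx = contradiction (P⊆Q px) ¬qx
  ... | yes _  | yes _  = s≤s (length-filter-strict any)
  ... | no  _  | yes _  = m≤n⇒m≤1+n (length-filter-strict any)
  ... | no  _  | no  _  = length-filter-strict any

Meets-mono : ∀ {n} {A E₁ E₂ : Subset n} → E₁ ⊆ E₂ → Meets A E₁ → Meets A E₂
Meets-mono {A = A} {E₁} E₁⊆E₂ (x , x∈A∩E₁) with x∈p∩q⁻ A E₁ x∈A∩E₁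
... | x∈A , x∈E₁ = x , x∈p∩q⁺ (x∈A , E₁⊆E₂ x∈E₁)

_meets?_ : ∀ {n} (A E : Subset n) → Dec (Meets A E)
A meets? E = nonempty? (A ∩ E)

yesCount : ∀ {n} → Subset n → List (Subset n) → ℕ
yesCount E 𝓕 = length (filter (_meets? E) 𝓕)

yesCount-strict : ∀ {n} {E₁ E₂ : Subset n} (𝓕 : List (Subset n)) → E₁ ⊆ E₂ →
                  Any (λ A → Meets A E₂ × ¬ Meets A E₁) 𝓕 → yesCount E₁ 𝓕 < yesCount E₂ 𝓕
yesCount-strict 𝓕 E₁⊆E₂ = length-filter-strict (_meets? _) (_meets? _) (Meets-mono E₁⊆E₂)

SameAnswers-refl : ∀ {n} (𝓕 : List (Subset n)) (E : Subset n) → SameAnswers 𝓕 E E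
SameAnswers-refl 𝓕 E = All.universal (λ _ → mk⇔ (λ m → m) (λ m → m)) 𝓕

isolating-query : ∀ {n} {H : History n} {𝓕 : List (Subset n)} {E : Subset n} {x : Fin n} →
                  ((E' : Subset n) → Consistent H E' → SameAnswers 𝓕 E E' → x ∈ E') →
                  Consistent H (E - x) → Any (λ A → Meets A E × ¬ Meets A (E - x)) 𝓕
isolating-query {𝓕 = 𝓕} {E} {x} x∈all E-x-consistent
  with any? (λ A → (A meets? E) ×-dec ¬? (A meets? (E - x))) 𝓕
... | yes isolating = isolating
... | no  ¬isolating =
  contradiction (x∈⁅x⁆ x) (x∈∁p⇒x∉p (p─q⊆∁q E ⁅ x ⁆ (x∈all (E - x) E-x-consistent same)))
  where
  same : SameAnswers 𝓕 E (E - x)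
  same = All.map (λ {A} ¬isolates → mk⇔
           (λ A-meets-E → decidable-stable (A meets? (E - x)) (λ ¬m → ¬isolates (A-meets-E , ¬m)))
           (Meets-mono (p─q⊆p E ⁅ x ⁆)))
         (¬Any⇒All¬ 𝓕 ¬isolating)

ConsistentAfterRemoving : ∀ {n} → History n → ℕ → Set
ConsistentAfterRemoving {n} H K = (T : Subset n) → ∣ T ∣ ≤ K → Consistent H (∁ (G H) ─ T)

module _ {n} {H : History n} {𝓕 : List (Subset n)} (suff : Suffices H 𝓕) {K : ℕ}
         (consistent : ConsistentAfterRemoving H K) (K≤∣∁G∣ : K ≤ ∣ ∁ (G H) ∣) where

  yesCount-drop : ∀ (T : Subset n) → ∣ T ∣ < K →
                  ∃ λ x → yesCount (∁ (G H) ─ T - x) 𝓕 < yesCount (∁ (G H) ─ T) 𝓕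
  yesCount-drop T ∣T∣<K with consistent T (<⇒≤ ∣T∣<K)
  ... | E-consistent with suff (∁ (G H) ─ T) E-consistent
  ...   | inj₁ all-empty = contradiction (∣p∣<∣q∣⇒q─p≢∅ (<-≤-trans ∣T∣<K K≤∣∁G∣))
                             (all-empty _ E-consistent (SameAnswers-refl 𝓕 _))
  ...   | inj₂ (x , x∈all) =
    x , yesCount-strict 𝓕 (p─q⊆p _ ⁅ x ⁆) (isolating-query {H = H} x∈all E-x-consistent)
    where
    E-x-consistent : Consistent H (∁ (G H) ─ T - x)
    E-x-consistent = subst (Consistent H) (sym (p─q─r≡p─q∪r (∁ (G H)) T ⁅ x ⁆))
                       (consistent (T ∪ ⁅ x ⁆) (≤-trans (∣p∪⁅x⁆∣≤1+∣p∣ T x) ∣T∣<K))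

  yesCount-lower-bound : ∀ j (T : Subset n) → ∣ T ∣ + j ≤ K → j ≤ yesCount (∁ (G H) ─ T) 𝓕
  yesCount-lower-bound zero    T _ = z≤n
  yesCount-lower-bound (suc j) T ∣T∣+1+j≤K
    with yesCount-drop T (<-≤-trans (m<m+n ∣ T ∣ (s≤s z≤n)) ∣T∣+1+j≤K)
  ... | x , drop = begin-strict
      j                                   ≤⟨ yesCount-lower-bound j (T ∪ ⁅ x ⁆) ∣T∪x∣+j≤K ⟩
      yesCount (∁ (G H) ─ (T ∪ ⁅ x ⁆)) 𝓕 ≡⟨ cong (λ S → yesCount S 𝓕) ∁G─T─x≡∁G─[T∪x] ⟨
      yesCount (∁ (G H) ─ T - x) 𝓕        <⟨ drop ⟩
      yesCount (∁ (G H) ─ T) 𝓕            ∎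
    where
    open ≤-Reasoning
    ∁G─T─x≡∁G─[T∪x] : ∁ (G H) ─ T - x ≡ ∁ (G H) ─ (T ∪ ⁅ x ⁆)
    ∁G─T─x≡∁G─[T∪x] = p─q─r≡p─q∪r (∁ (G H)) T ⁅ x ⁆
    ∣T∪x∣+j≤K : ∣ T ∪ ⁅ x ⁆ ∣ + j ≤ K
    ∣T∪x∣+j≤K = begin
      ∣ T ∪ ⁅ x ⁆ ∣ + j ≤⟨ +-monoˡ-≤ j (∣p∪⁅x⁆∣≤1+∣p∣ T x) ⟩
      suc ∣ T ∣ + j     ≡⟨ sym (+-suc ∣ T ∣ j) ⟩
      ∣ T ∣ + suc j     ≤⟨ ∣T∣+1+j≤K ⟩
      K                 ∎

  length-lower-bound : K ≤ length 𝓕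
  length-lower-bound = begin
    K                          ≤⟨ yesCount-lower-bound K ∅ (≤-reflexive (cong (_+ K) (∣⊥∣≡0 n))) ⟩
    yesCount (∁ (G H) ─ ∅) 𝓕  ≤⟨ length-filter (_meets? _) 𝓕 ⟩
    length 𝓕                  ∎
    where open ≤-Reasoning

yesQ≡[] : ∀ {n} (R : Round n) → ¬ Any (λ q → proj₂ q ≡ true) R → yesQ R ≡ []
yesQ≡[] []                _    = refl
yesQ≡[] ((_ , true)  ∷ R) ¬yes = contradiction (here refl) ¬yes
yesQ≡[] ((_ , false) ∷ R) ¬yes = yesQ≡[] R (¬yes ∘′ there)

allYes≡[] : ∀ {n} (H : History n) → ¬ SomeYes H → allYes H ≡ []
allYes≡[] []      _    = refl
allYes≡[] (R ∷ H) ¬yes rewrite yesQ≡[] R (¬yes ∘′ here) = allYes≡[] H (¬yes ∘′ there)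

consistentAfterRemoving-¬SomeYes : ∀ {n} (H : History n) → ¬ SomeYes H → ∀ K → ConsistentAfterRemoving H K
consistentAfterRemoving-¬SomeYes H ¬yes K T _ =
  p⊆∁q⇒Empty[p∩q] (p─q⊆p _ T) , subst (All _) (sym (cong (map (_─ G H)) (allYes≡[] H ¬yes))) []

𝓖⊆∁G : ∀ {n} (H : History n) → All (_⊆ ∁ (G H)) (𝓖 H)
𝓖⊆∁G H = map⁺ (All.universal (λ F {x} → p─q⊆∁q F (G H) {x}) (allYes H))

foldr-⊓≤init : ∀ {n} (a : ℕ) (Bs : List (Subset n)) → foldr (λ C acc → ∣ C ∣ ⊓ acc) a Bs ≤ a
foldr-⊓≤init a []       = ≤-refl
foldr-⊓≤init a (C ∷ Cs) = ≤-trans (m⊓n≤n ∣ C ∣ _) (foldr-⊓≤init a Cs)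

foldr-⊓≤∈ : ∀ {n} (a : ℕ) {B : Subset n} (Bs : List (Subset n)) → B ∈ₗ Bs →
            foldr (λ C acc → ∣ C ∣ ⊓ acc) a Bs ≤ ∣ B ∣
foldr-⊓≤∈ a (C ∷ Cs) (here refl) = m⊓n≤m ∣ C ∣ _
foldr-⊓≤∈ a (C ∷ Cs) (there B∈)  = ≤-trans (m⊓n≤n ∣ C ∣ _) (foldr-⊓≤∈ a Cs B∈)

minSize≤∣B∣ : ∀ {n} {B : Subset n} (Bs : List (Subset n)) → B ∈ₗ Bs → minSize Bs ≤ ∣ B ∣
minSize≤∣B∣ (C ∷ Cs) (here refl) = foldr-⊓≤init ∣ C ∣ Cs
minSize≤∣B∣ (C ∷ Cs) (there B∈)  = foldr-⊓≤∈ ∣ C ∣ Cs B∈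

-- for an empty family minSize is the junk value 0, which satisfies any upper bound
minSize≤ : ∀ {n k} (Bs : List (Subset n)) → (∀ {B} → B ∈ₗ Bs → ∣ B ∣ ≤ k) → minSize Bs ≤ k
minSize≤ []       _     = z≤n
minSize≤ (B ∷ Bs) ∣·∣≤k = ≤-trans (minSize≤∣B∣ (B ∷ Bs) (here refl)) (∣·∣≤k (here refl))

m≤∣∁G∣ : ∀ {n} (H : History n) → m H ≤ ∣ ∁ (G H) ∣
m≤∣∁G∣ H = minSize≤ (𝓖 H) (λ B∈ → p⊆q⇒∣p∣≤∣q∣ (All.lookup (𝓖⊆∁G H) B∈))

consistent-∁G─T : ∀ {n} (H : History n) (T : Subset n) → ∣ T ∣ < m H → Consistent H (∁ (G H) ─ T)
consistent-∁G─T H T ∣T∣<m = p⊆∁q⇒Empty[p∩q] (p─q⊆p _ T) , All.tabulate meets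
  where
  meets : ∀ {B} → B ∈ₗ 𝓖 H → Meets B (∁ (G H) ─ T)
  meets {B} B∈ with ∣p∣<∣q∣⇒q─p≢∅ (<-≤-trans ∣T∣<m (minSize≤∣B∣ (𝓖 H) B∈))
  ... | x , x∈B─T = x , x∈p∩q⁺ (p─q⊆p B T x∈B─T , x∈p∧x∉q⇒x∈p─q x∈∁G x∉T)
    where
    x∈∁G : x ∈ ∁ (G H)
    x∈∁G = All.lookup (𝓖⊆∁G H) B∈ (p─q⊆p B T x∈B─T)
    x∉T : x ∉ T
    x∉T = x∈∁p⇒x∉p (p─q⊆∁q B T x∈B─T)

length≥m∸1 : ∀ {n} (H : History n) {𝓕 : List (Subset n)} → Suffices H 𝓕 → m H ∸ 1 ≤ length 𝓕
length≥m∸1 H {𝓕} suff with m H | consistent-∁G─T H | m≤∣∁G∣ H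
... | zero  | _          | _        = z≤n
... | suc k | consistent | k<∣∁G∣ =
  length-lower-bound {H = H} {𝓕} suff (λ T ∣T∣≤k → consistent T (s≤s ∣T∣≤k)) (<⇒≤ k<∣∁G∣)

length≥n∸∣G∣ : ∀ {n} (H : History n) {𝓕 : List (Subset n)} → ¬ SomeYes H → Suffices H 𝓕 →
               n ∸ ∣ G H ∣ ≤ length 𝓕
length≥n∸∣G∣ H {𝓕} ¬yes suff =
  subst (_≤ length 𝓕) (∣∁p∣≡n∸∣p∣ (G H))
    (length-lower-bound {H = H} {𝓕} suff (consistentAfterRemoving-¬SomeYes H ¬yes _) ≤-refl)

lemma2p2 : (r n : ℕ) → 2 ≤ r → 1 ≤ n →
    (H : History n) → length H ≡ r ∸ 1 → Convention H →
    (∃ λ (E₀ : Subset n) → Consistent H E₀) →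
    (𝓕 : List (Subset n)) → Unique 𝓕 → All (λ A → A ⊆ ∁ (G H)) 𝓕 →
    Suffices H 𝓕 →
    (SomeYes H → m H ∸ 1 ≤ length 𝓕)
    × (¬ SomeYes H → n ∸ ∣ G H ∣ ≤ length 𝓕)
lemma2p2 _ _ _ _ H _ _ _ 𝓕 _ _ suff = (λ _ → length≥m∸1 H suff) , (λ ¬yes → length≥n∸∣G∣ H ¬yes suff)
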